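{- A pair $(I,J)$ occurs as the invariants $(I(f),J(f))$ of some integral ternary cubic form $f$ if and only if it occurs as the invariants of some Weierstrass cubic over $\mathbb{Z}$, i.e. of a form $y^2z+a_1xyz+a_3yz^2-x^3-a_2x^2z-a_4xz^2-a_6z^3$ with $a_1,a_2,a_3,a_4,a_6\in\mathbb{Z}$.
   Context: An integral ternary cubic form is $f=\sum_{i+j+k=3}a_{ijk}x^iy^jz^k$ with $a_{ijk}\in\mathbb{Z}$. $\mathcal{H}(f)$ is its Hessian (determinant of the matrix of second partials). $I(f),J(f)$ are the $\mathrm{SL}_3$-invariant polynomials of degrees $4,6$ in the coefficients determined by $\mathcal{H}(\mathcal{H}(f))=12288\,I(f)^2f+512\,J(f)\mathcal{H}(f)$, normalized so that $x^3+Axz^2+Bz^3-y^2z$ has $I=-3A$, $J=-27B$. -}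

module Defs where

open import Data.Integer using (ℤ; +_; -_; _+_; _*_)
open import Data.Rational using (ℚ; _/_)

-- An integral ternary cubic form
--   f = Σ_{i+j+k=3} a_ijk x^i y^j z^k ,  a_ijk ∈ ℤ,
-- represented by its ten coefficients (field aijk = coefficient of x^i y^j z^k).
record TernaryCubic : Set where
  constructor mkCubic
  field
    a003 a012 a021 a030 a102 a111 a120 a201 a210 a300 : ℤ



I-numer : TernaryCubic → ℤ
I-numer f =
    (+ 144) * a003 * a021 * a120 * a300
    + (- (+ 48)) * a003 * a021 * a210 * a210
    + (- (+ 216)) * a003 * a030 * a111 * a300
    + (+ 144) * a003 * a030 * a201 * a210
    + (+ 24) * a003 * a111 * a120 * a210
    + (- (+ 48)) * a003 * a120 * a120 * a201
    + (- (+ 48)) * a012 * a012 * a120 * a300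
    + (+ 16) * a012 * a012 * a210 * a210
    + (+ 24) * a012 * a021 * a111 * a300
    + (- (+ 16)) * a012 * a021 * a201 * a210
    + (+ 144) * a012 * a030 * a102 * a300
    + (- (+ 48)) * a012 * a030 * a201 * a201
    + (- (+ 16)) * a012 * a102 * a120 * a210
    + (- (+ 8)) * a012 * a111 * a111 * a210
    + (+ 24) * a012 * a111 * a120 * a201
    + (- (+ 48)) * a021 * a021 * a102 * a300
    + (+ 16) * a021 * a021 * a201 * a201
    + (+ 24) * a021 * a102 * a111 * a210
    + (- (+ 16)) * a021 * a102 * a120 * a201
    + (- (+ 8)) * a021 * a111 * a111 * a201
    + (- (+ 48)) * a030 * a102 * a102 * a210
    + (+ 24) * a030 * a102 * a111 * a201
    + (+ 16) * a102 * a102 * a120 * a120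
    + (- (+ 8)) * a102 * a111 * a111 * a120
    + (+ 1) * a111 * a111 * a111 * a111
  where open TernaryCubic f

J-numer : TernaryCubic → ℤ
J-numer f =
    (+ 5832) * a003 * a003 * a030 * a030 * a300 * a300
    + (- (+ 3888)) * a003 * a003 * a030 * a120 * a210 * a300
    + (+ 864) * a003 * a003 * a030 * a210 * a210 * a210
    + (+ 864) * a003 * a003 * a120 * a120 * a120 * a300
    + (- (+ 216)) * a003 * a003 * a120 * a120 * a210 * a210
    + (- (+ 3888)) * a003 * a012 * a021 * a030 * a300 * a300
    + (+ 1296) * a003 * a012 * a021 * a120 * a210 * a300
    + (- (+ 288)) * a003 * a012 * a021 * a210 * a210 * a210
    + (+ 1296) * a003 * a012 * a030 * a111 * a210 * a300
    + (+ 1296) * a003 * a012 * a030 * a120 * a201 * a300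
    + (- (+ 864)) * a003 * a012 * a030 * a201 * a210 * a210
    + (- (+ 864)) * a003 * a012 * a111 * a120 * a120 * a300
    + (+ 144) * a003 * a012 * a111 * a120 * a210 * a210
    + (+ 144) * a003 * a012 * a120 * a120 * a201 * a210
    + (+ 864) * a003 * a021 * a021 * a021 * a300 * a300
    + (- (+ 864)) * a003 * a021 * a021 * a111 * a210 * a300
    + (- (+ 864)) * a003 * a021 * a021 * a120 * a201 * a300
    + (+ 576) * a003 * a021 * a021 * a201 * a210 * a210
    + (+ 1296) * a003 * a021 * a030 * a102 * a210 * a300
    + (+ 1296) * a003 * a021 * a030 * a111 * a201 * a300
    + (- (+ 864)) * a003 * a021 * a030 * a201 * a201 * a210
    + (- (+ 864)) * a003 * a021 * a102 * a120 * a120 * a300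
    + (+ 144) * a003 * a021 * a102 * a120 * a210 * a210
    + (+ 648) * a003 * a021 * a111 * a111 * a120 * a300
    + (+ 72) * a003 * a021 * a111 * a111 * a210 * a210
    + (- (+ 720)) * a003 * a021 * a111 * a120 * a201 * a210
    + (+ 576) * a003 * a021 * a120 * a120 * a201 * a201
    + (- (+ 3888)) * a003 * a030 * a030 * a102 * a201 * a300
    + (+ 864) * a003 * a030 * a030 * a201 * a201 * a201
    + (+ 1296) * a003 * a030 * a102 * a111 * a120 * a300
    + (- (+ 864)) * a003 * a030 * a102 * a111 * a210 * a210
    + (+ 1296) * a003 * a030 * a102 * a120 * a201 * a210
    + (- (+ 540)) * a003 * a030 * a111 * a111 * a111 * a300
    + (+ 648) * a003 * a030 * a111 * a111 * a201 * a210
    + (- (+ 864)) * a003 * a030 * a111 * a120 * a201 * a201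
    + (+ 144) * a003 * a102 * a111 * a120 * a120 * a210
    + (- (+ 288)) * a003 * a102 * a120 * a120 * a120 * a201
    + (- (+ 36)) * a003 * a111 * a111 * a111 * a120 * a210
    + (+ 72) * a003 * a111 * a111 * a120 * a120 * a201
    + (+ 864) * a012 * a012 * a012 * a030 * a300 * a300
    + (- (+ 288)) * a012 * a012 * a012 * a120 * a210 * a300
    + (+ 64) * a012 * a012 * a012 * a210 * a210 * a210
    + (- (+ 216)) * a012 * a012 * a021 * a021 * a300 * a300
    + (+ 144) * a012 * a012 * a021 * a111 * a210 * a300
    + (+ 144) * a012 * a012 * a021 * a120 * a201 * a300
    + (- (+ 96)) * a012 * a012 * a021 * a201 * a210 * a210
    + (- (+ 864)) * a012 * a012 * a030 * a102 * a210 * a300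
    + (- (+ 864)) * a012 * a012 * a030 * a111 * a201 * a300
    + (+ 576) * a012 * a012 * a030 * a201 * a201 * a210
    + (+ 576) * a012 * a012 * a102 * a120 * a120 * a300
    + (- (+ 96)) * a012 * a012 * a102 * a120 * a210 * a210
    + (+ 72) * a012 * a012 * a111 * a111 * a120 * a300
    + (- (+ 48)) * a012 * a012 * a111 * a111 * a210 * a210
    + (+ 144) * a012 * a012 * a111 * a120 * a201 * a210
    + (- (+ 216)) * a012 * a012 * a120 * a120 * a201 * a201
    + (+ 144) * a012 * a021 * a021 * a102 * a210 * a300
    + (+ 144) * a012 * a021 * a021 * a111 * a201 * a300
    + (- (+ 96)) * a012 * a021 * a021 * a201 * a201 * a210
    + (+ 1296) * a012 * a021 * a030 * a102 * a201 * a300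
    + (- (+ 288)) * a012 * a021 * a030 * a201 * a201 * a201
    + (- (+ 720)) * a012 * a021 * a102 * a111 * a120 * a300
    + (+ 144) * a012 * a021 * a102 * a111 * a210 * a210
    + (- (+ 48)) * a012 * a021 * a102 * a120 * a201 * a210
    + (- (+ 36)) * a012 * a021 * a111 * a111 * a111 * a300
    + (- (+ 24)) * a012 * a021 * a111 * a111 * a201 * a210
    + (+ 144) * a012 * a021 * a111 * a120 * a201 * a201
    + (- (+ 864)) * a012 * a030 * a102 * a102 * a120 * a300
    + (+ 576) * a012 * a030 * a102 * a102 * a210 * a210
    + (+ 648) * a012 * a030 * a102 * a111 * a111 * a300
    + (- (+ 720)) * a012 * a030 * a102 * a111 * a201 * a210
    + (+ 144) * a012 * a030 * a102 * a120 * a201 * a201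
    + (+ 72) * a012 * a030 * a111 * a111 * a201 * a201
    + (- (+ 96)) * a012 * a102 * a102 * a120 * a120 * a210
    + (- (+ 24)) * a012 * a102 * a111 * a111 * a120 * a210
    + (+ 144) * a012 * a102 * a111 * a120 * a120 * a201
    + (+ 12) * a012 * a111 * a111 * a111 * a111 * a210
    + (- (+ 36)) * a012 * a111 * a111 * a111 * a120 * a201
    + (- (+ 288)) * a021 * a021 * a021 * a102 * a201 * a300
    + (+ 64) * a021 * a021 * a021 * a201 * a201 * a201
    + (+ 576) * a021 * a021 * a102 * a102 * a120 * a300
    + (- (+ 216)) * a021 * a021 * a102 * a102 * a210 * a210
    + (+ 72) * a021 * a021 * a102 * a111 * a111 * a300
    + (+ 144) * a021 * a021 * a102 * a111 * a201 * a210
    + (- (+ 96)) * a021 * a021 * a102 * a120 * a201 * a201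
    + (- (+ 48)) * a021 * a021 * a111 * a111 * a201 * a201
    + (- (+ 864)) * a021 * a030 * a102 * a102 * a111 * a300
    + (+ 144) * a021 * a030 * a102 * a102 * a201 * a210
    + (+ 144) * a021 * a030 * a102 * a111 * a201 * a201
    + (+ 144) * a021 * a102 * a102 * a111 * a120 * a210
    + (- (+ 96)) * a021 * a102 * a102 * a120 * a120 * a201
    + (- (+ 36)) * a021 * a102 * a111 * a111 * a111 * a210
    + (- (+ 24)) * a021 * a102 * a111 * a111 * a120 * a201
    + (+ 12) * a021 * a111 * a111 * a111 * a111 * a201
    + (+ 864) * a030 * a030 * a102 * a102 * a102 * a300
    + (- (+ 216)) * a030 * a030 * a102 * a102 * a201 * a201
    + (- (+ 288)) * a030 * a102 * a102 * a102 * a120 * a210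
    + (+ 72) * a030 * a102 * a102 * a111 * a111 * a210
    + (+ 144) * a030 * a102 * a102 * a111 * a120 * a201
    + (- (+ 36)) * a030 * a102 * a111 * a111 * a111 * a201
    + (+ 64) * a102 * a102 * a102 * a120 * a120 * a120
    + (- (+ 48)) * a102 * a102 * a111 * a111 * a120 * a120
    + (+ 12) * a102 * a111 * a111 * a111 * a111 * a120
    + (- (+ 1)) * a111 * a111 * a111 * a111 * a111 * a111
  where open TernaryCubic f

-- The SL₃-invariants I(f) (degree 4) and J(f) (degree 6), with values in ℚ:
-- the unique invariants with  H(H(f)) = 12288 I(f)² f + 512 J(f) H(f)  and
-- I = -3A, J = -27B  for  x³ + A x z² + B z³ - y² z.
invI : TernaryCubic → ℚ
invI f = I-numer f / 16

invJ : TernaryCubic → ℚ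
invJ f = J-numer f / 32

weierstrassCubic : (a₁ a₂ a₃ a₄ a₆ : ℤ) → TernaryCubic
weierstrassCubic a₁ a₂ a₃ a₄ a₆ = record
  { a300 = - (+ 1) ; a210 = + 0 ; a201 = - a₂ ; a120 = + 0 ; a111 = a₁
  ; a102 = - a₄ ; a030 = + 0 ; a021 = + 1 ; a012 = a₃ ; a003 = - a₆ }

-- For a Weierstrass cubic, 16 I and 32 J are the classical invariants c₄ and c₆ of its
-- coefficients a₁, …, a₆. Conversely, Artin, Rodriguez-Villegas and Tate give a Weierstrass
-- model of the Jacobian of the plane cubic f = 0 whose coefficients are integer polynomials
-- in the coefficients of f, and c₄, c₆ of that model are 16 I(f), 32 J(f) identically. So the
-- invariants of any integral ternary cubic are those of an integral Weierstrass cubic; the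
-- converse is trivial.
module Submission where

open import Defs
open import Data.Integer using (ℤ)
open import Data.Rational using (ℚ)
open import Data.Product using (Σ; _×_; ∃-syntax)
open import Function.Bundles using (_⇔_)
open import Relation.Binary.PropositionalEquality using (_≡_)

open import Data.Fin using (#_)
open import Data.Integer using (+-*-rawRing)
import Data.Integer as ℤ using (+_; _≟_)
open import Data.Nat using (ℕ)
open import Data.Product using (_,_)
import Data.Rational as ℚ using (_/_)
open import Data.Vec as Vec using (Vec; []; _∷_)
open import Function using (id)
open import Function.Bundles using (mk⇔)
open import Relation.Binary.PropositionalEquality using (refl; trans; cong; module ≡-Reasoning)
open import Tactic.RingSolver.Core.Expression using (Expr; Κ; Ι; _⊕_; _⊗_; _⊛_; ⊝_; module Eval)

open Eval +-*-rawRing id using (⟦_⟧)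

private variable m n : ℕ

module SparsePolynomial where
  open import Algebra.Bundles using (RawRing)
  open import Algebra.Definitions.RawSemiring (RawRing.rawSemiring +-*-rawRing) using (_^′_)
  open import Data.Bool using (Bool; true; false; _∧_; _∨_; if_then_else_)
  open import Data.Fin using (Fin; zero; suc)
  open import Data.Integer using (0ℤ; 1ℤ; _+_; _*_; -_; _^_)
  open import Data.Integer.Properties
    using (^-distribˡ-+-*; *-identityˡ; *-identityʳ; *-zeroˡ; *-zeroʳ; *-distribʳ-+; +-identityˡ; +-identityʳ; +-assoc)
  open import Data.Integer.Tactic.RingSolver using (solve-∀)
  open import Data.List as List using (List; []; _∷_)
  import Data.List.Properties as List using (≡-dec)
  open import Data.Nat using (suc; _<ᵇ_; _≡ᵇ_)
  import Data.Nat as ℕ using (_+_; _≟_)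
  import Data.Product.Properties as × using (≡-dec)
  open import Data.Vec using (zipWith; replicate; lookup)
  open import Data.Vec.Properties using (≡-dec; lookup-map)
  open import Relation.Binary.Definitions using (DecidableEquality)
  open import Relation.Binary.PropositionalEquality using (sym; cong₂)
  open import Relation.Nullary using (yes; no; does)
  open import Relation.Nullary.Decidable using (True; toWitness)

  Monomial : ℕ → Set
  Monomial = Vec ℕ

  ⟦_⟧ₘ : Monomial n → Vec ℤ n → ℤ
  ⟦ [] ⟧ₘ [] = 1ℤ
  ⟦ e ∷ m ⟧ₘ (x ∷ ρ) = x ^ e * ⟦ m ⟧ₘ ρ

  _·ₘ_ : Monomial n → Monomial n → Monomial n
  _·ₘ_ = zipWith ℕ._+_

  _<ₘ_ : Monomial n → Monomial n → Bool
  [] <ₘ [] = false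
  (e ∷ m) <ₘ (e′ ∷ m′) = (e <ᵇ e′) ∨ ((e ≡ᵇ e′) ∧ (m <ₘ m′))

  _≟ₘ_ : DecidableEquality (Monomial n)
  _≟ₘ_ = ≡-dec ℕ._≟_

  unitₘ : Fin n → Monomial n
  unitₘ zero = 1 ∷ replicate _ 0
  unitₘ (suc i) = 0 ∷ unitₘ i

  ·ₘ-homo : ∀ (m m′ : Monomial n) ρ → ⟦ m ·ₘ m′ ⟧ₘ ρ ≡ ⟦ m ⟧ₘ ρ * ⟦ m′ ⟧ₘ ρ
  ·ₘ-homo [] [] [] = refl
  ·ₘ-homo (e ∷ m) (e′ ∷ m′) (x ∷ ρ) = begin
    x ^ (e ℕ.+ e′) * ⟦ m ·ₘ m′ ⟧ₘ ρ              ≡⟨ cong₂ _*_ (^-distribˡ-+-* x e e′) (·ₘ-homo m m′ ρ) ⟩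
    x ^ e * x ^ e′ * (⟦ m ⟧ₘ ρ * ⟦ m′ ⟧ₘ ρ)       ≡⟨ interchange (x ^ e) (x ^ e′) (⟦ m ⟧ₘ ρ) (⟦ m′ ⟧ₘ ρ) ⟩
    x ^ e * ⟦ m ⟧ₘ ρ * (x ^ e′ * ⟦ m′ ⟧ₘ ρ)       ∎
    where
    open ≡-Reasoning
    interchange : ∀ a b c d → a * b * (c * d) ≡ a * c * (b * d)
    interchange = solve-∀

  replicate-0-homo : ∀ ρ → ⟦ replicate n 0 ⟧ₘ ρ ≡ 1ℤ
  replicate-0-homo [] = refl
  replicate-0-homo (x ∷ ρ) = trans (*-identityˡ _) (replicate-0-homo ρ)

  unitₘ-homo : ∀ (i : Fin n) ρ → ⟦ unitₘ i ⟧ₘ ρ ≡ lookup ρ i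
  unitₘ-homo zero (x ∷ ρ) = trans (cong (x ^ 1 *_) (replicate-0-homo ρ)) (trans (*-identityʳ (x ^ 1)) (*-identityʳ x))
  unitₘ-homo (suc i) (x ∷ ρ) = trans (*-identityˡ _) (unitₘ-homo i ρ)

  Poly : ℕ → Set
  Poly n = List (ℤ × Monomial n)

  ⟦_⟧ₚ : Poly n → Vec ℤ n → ℤ
  ⟦ [] ⟧ₚ ρ = 0ℤ
  ⟦ (c , m) ∷ p ⟧ₚ ρ = c * ⟦ m ⟧ₘ ρ + ⟦ p ⟧ₚ ρ

  -- Polynomials are kept sorted by _<ₘ_ and free of zero coefficients, so that equal
  -- polynomials get equal normal forms; soundness does not depend on this invariant.

  infixr 5 _∷?_
  _∷?_ : ℤ × Monomial n → Poly n → Poly n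
  (c , m) ∷? p with c ℤ.≟ 0ℤ
  ... | yes _ = p
  ... | no _  = (c , m) ∷ p

  ∷?-homo : ∀ (t : ℤ × Monomial n) p ρ → ⟦ t ∷? p ⟧ₚ ρ ≡ ⟦ t ∷ p ⟧ₚ ρ
  ∷?-homo (c , m) p ρ with c ℤ.≟ 0ℤ
  ... | yes refl = sym (trans (cong (_+ ⟦ p ⟧ₚ ρ) (*-zeroˡ (⟦ m ⟧ₘ ρ))) (+-identityˡ _))
  ... | no _     = refl

  -- Written with if rather than with, and +ᴾ-homo makes its recursive calls before the case
  -- split: behind a with they would no longer be recognised as structurally smaller.
  infixl 6 _+ᴾ_
  _+ᴾ_ : Poly n → Poly n → Poly n
  [] +ᴾ q = q
  (t ∷ p) +ᴾ [] = t ∷ p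
  ((c , m) ∷ p) +ᴾ ((c′ , m′) ∷ q) =
    if does (m ≟ₘ m′) then (c + c′ , m) ∷? p +ᴾ q
    else if m <ₘ m′ then (c , m) ∷ (p +ᴾ ((c′ , m′) ∷ q))
    else (c′ , m′) ∷ (((c , m) ∷ p) +ᴾ q)

  +ᴾ-homo : ∀ (p q : Poly n) ρ → ⟦ p +ᴾ q ⟧ₚ ρ ≡ ⟦ p ⟧ₚ ρ + ⟦ q ⟧ₚ ρ
  +ᴾ-homo [] q ρ = sym (+-identityˡ _)
  +ᴾ-homo (t ∷ p) [] ρ = sym (+-identityʳ _)
  +ᴾ-homo ((c , m) ∷ p) ((c′ , m′) ∷ q) ρ
    with +ᴾ-homo p q ρ | +ᴾ-homo p ((c′ , m′) ∷ q) ρ | +ᴾ-homo ((c , m) ∷ p) q ρ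
  ... | ih | ihˡ | ihʳ with m ≟ₘ m′ | m <ₘ m′
  ... | yes refl | _ = begin
    ⟦ (c + c′ , m) ∷? p +ᴾ q ⟧ₚ ρ             ≡⟨ ∷?-homo (c + c′ , m) (p +ᴾ q) ρ ⟩
    (c + c′) * ⟦ m ⟧ₘ ρ + ⟦ p +ᴾ q ⟧ₚ ρ       ≡⟨ cong (_+_ ((c + c′) * ⟦ m ⟧ₘ ρ)) ih ⟩
    (c + c′) * ⟦ m ⟧ₘ ρ + (⟦ p ⟧ₚ ρ + ⟦ q ⟧ₚ ρ) ≡⟨ collect c c′ (⟦ m ⟧ₘ ρ) (⟦ p ⟧ₚ ρ) (⟦ q ⟧ₚ ρ) ⟩
    c * ⟦ m ⟧ₘ ρ + ⟦ p ⟧ₚ ρ + (c′ * ⟦ m ⟧ₘ ρ + ⟦ q ⟧ₚ ρ) ∎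
    where
    open ≡-Reasoning
    collect : ∀ c c′ x u v → (c + c′) * x + (u + v) ≡ c * x + u + (c′ * x + v)
    collect = solve-∀
  ... | no _ | true = trans (cong (_+_ (c * ⟦ m ⟧ₘ ρ)) ihˡ) (sym (+-assoc (c * ⟦ m ⟧ₘ ρ) (⟦ p ⟧ₚ ρ) _))
  ... | no _ | false = trans (cong (_+_ (c′ * ⟦ m′ ⟧ₘ ρ)) ihʳ) (swap (c′ * ⟦ m′ ⟧ₘ ρ) (⟦ (c , m) ∷ p ⟧ₚ ρ) (⟦ q ⟧ₚ ρ))
    where
    swap : ∀ a b c → a + (b + c) ≡ b + (a + c)
    swap = solve-∀

  -ᴾ_ : Poly n → Poly n
  -ᴾ [] = []
  -ᴾ ((c , m) ∷ p) = (- c , m) ∷ -ᴾ p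

  -ᴾ-homo : ∀ (p : Poly n) ρ → ⟦ -ᴾ p ⟧ₚ ρ ≡ - ⟦ p ⟧ₚ ρ
  -ᴾ-homo [] ρ = refl
  -ᴾ-homo ((c , m) ∷ p) ρ = trans (cong (_+_ ((- c) * ⟦ m ⟧ₘ ρ)) (-ᴾ-homo p ρ)) (negate c (⟦ m ⟧ₘ ρ) (⟦ p ⟧ₚ ρ))
    where
    negate : ∀ c x u → (- c) * x + - u ≡ - (c * x + u)
    negate = solve-∀

  infixl 7 _*ₜ_ _*ᴾ_
  _*ₜ_ : ℤ × Monomial n → Poly n → Poly n
  t *ₜ [] = []
  (c , m) *ₜ ((c′ , m′) ∷ p) = (c * c′ , m ·ₘ m′) ∷ (c , m) *ₜ p

  *ₜ-homo : ∀ c (m : Monomial n) p ρ → ⟦ (c , m) *ₜ p ⟧ₚ ρ ≡ c * ⟦ m ⟧ₘ ρ * ⟦ p ⟧ₚ ρ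
  *ₜ-homo c m [] ρ = sym (*-zeroʳ (c * ⟦ m ⟧ₘ ρ))
  *ₜ-homo c m ((c′ , m′) ∷ p) ρ = begin
    c * c′ * ⟦ m ·ₘ m′ ⟧ₘ ρ + ⟦ (c , m) *ₜ p ⟧ₚ ρ               ≡⟨ cong₂ (λ u v → c * c′ * u + v) (·ₘ-homo m m′ ρ) (*ₜ-homo c m p ρ) ⟩
    c * c′ * (⟦ m ⟧ₘ ρ * ⟦ m′ ⟧ₘ ρ) + c * ⟦ m ⟧ₘ ρ * ⟦ p ⟧ₚ ρ ≡⟨ factor c c′ (⟦ m ⟧ₘ ρ) (⟦ m′ ⟧ₘ ρ) (⟦ p ⟧ₚ ρ) ⟩
    c * ⟦ m ⟧ₘ ρ * (c′ * ⟦ m′ ⟧ₘ ρ + ⟦ p ⟧ₚ ρ)                 ∎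
    where
    open ≡-Reasoning
    factor : ∀ c c′ x x′ u → c * c′ * (x * x′) + c * x * u ≡ c * x * (c′ * x′ + u)
    factor = solve-∀

  _*ᴾ_ : Poly n → Poly n → Poly n
  [] *ᴾ q = []
  (t ∷ p) *ᴾ q = t *ₜ q +ᴾ p *ᴾ q

  *ᴾ-homo : ∀ (p q : Poly n) ρ → ⟦ p *ᴾ q ⟧ₚ ρ ≡ ⟦ p ⟧ₚ ρ * ⟦ q ⟧ₚ ρ
  *ᴾ-homo [] q ρ = sym (*-zeroˡ (⟦ q ⟧ₚ ρ))
  *ᴾ-homo ((c , m) ∷ p) q ρ = begin
    ⟦ (c , m) *ₜ q +ᴾ p *ᴾ q ⟧ₚ ρ                       ≡⟨ +ᴾ-homo ((c , m) *ₜ q) (p *ᴾ q) ρ ⟩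
    ⟦ (c , m) *ₜ q ⟧ₚ ρ + ⟦ p *ᴾ q ⟧ₚ ρ                  ≡⟨ cong₂ _+_ (*ₜ-homo c m q ρ) (*ᴾ-homo p q ρ) ⟩
    c * ⟦ m ⟧ₘ ρ * ⟦ q ⟧ₚ ρ + ⟦ p ⟧ₚ ρ * ⟦ q ⟧ₚ ρ         ≡⟨ sym (*-distribʳ-+ (⟦ q ⟧ₚ ρ) (c * ⟦ m ⟧ₘ ρ) (⟦ p ⟧ₚ ρ)) ⟩
    (c * ⟦ m ⟧ₘ ρ + ⟦ p ⟧ₚ ρ) * ⟦ q ⟧ₚ ρ                  ∎
    where open ≡-Reasoning

  κ : ℤ → Poly n
  κ c = (c , replicate _ 0) ∷? []

  κ-homo : ∀ c (ρ : Vec ℤ n) → ⟦ κ c ⟧ₚ ρ ≡ c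
  κ-homo c ρ = begin
    ⟦ (c , replicate _ 0) ∷? [] ⟧ₚ ρ ≡⟨ ∷?-homo (c , replicate _ 0) [] ρ ⟩
    c * ⟦ replicate _ 0 ⟧ₘ ρ + 0ℤ   ≡⟨ +-identityʳ _ ⟩
    c * ⟦ replicate _ 0 ⟧ₘ ρ        ≡⟨ cong (c *_) (replicate-0-homo ρ) ⟩
    c * 1ℤ                          ≡⟨ *-identityʳ c ⟩
    c                               ∎
    where open ≡-Reasoning

  ι : Fin n → Poly n
  ι i = (1ℤ , unitₘ i) ∷ []

  ι-homo : ∀ (i : Fin n) ρ → ⟦ ι i ⟧ₚ ρ ≡ lookup ρ i
  ι-homo i ρ = trans (+-identityʳ _) (trans (*-identityˡ _) (unitₘ-homo i ρ))

  _^ᴾ_ : Poly n → ℕ → Poly n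
  p ^ᴾ 0 = κ 1ℤ
  p ^ᴾ 1 = p
  p ^ᴾ suc k = p ^ᴾ k *ᴾ p

  ^ᴾ-homo : ∀ (p : Poly n) k ρ → ⟦ p ^ᴾ k ⟧ₚ ρ ≡ ⟦ p ⟧ₚ ρ ^′ k
  ^ᴾ-homo p 0 ρ = κ-homo 1ℤ ρ
  ^ᴾ-homo p 1 ρ = refl
  ^ᴾ-homo p (suc (suc k)) ρ = trans (*ᴾ-homo (p ^ᴾ suc k) p ρ) (cong (_* ⟦ p ⟧ₚ ρ) (^ᴾ-homo p (suc k) ρ))

  normalise : Expr ℤ n → Poly n
  normalise (Κ c) = κ c
  normalise (Ι i) = ι i
  normalise (e ⊕ e′) = normalise e +ᴾ normalise e′
  normalise (e ⊗ e′) = normalise e *ᴾ normalise e′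
  normalise (e ⊛ k) = normalise e ^ᴾ k
  normalise (⊝ e) = -ᴾ normalise e

  normalise-correct : ∀ (e : Expr ℤ n) ρ → ⟦ normalise e ⟧ₚ ρ ≡ ⟦ e ⟧ ρ
  normalise-correct (Κ c) ρ = κ-homo c ρ
  normalise-correct (Ι i) ρ = ι-homo i ρ
  normalise-correct (e ⊕ e′) ρ = trans (+ᴾ-homo (normalise e) (normalise e′) ρ) (cong₂ _+_ (normalise-correct e ρ) (normalise-correct e′ ρ))
  normalise-correct (e ⊗ e′) ρ = trans (*ᴾ-homo (normalise e) (normalise e′) ρ) (cong₂ _*_ (normalise-correct e ρ) (normalise-correct e′ ρ))
  normalise-correct (e ⊛ k) ρ = trans (^ᴾ-homo (normalise e) k ρ) (cong (_^′ k) (normalise-correct e ρ))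
  normalise-correct (⊝ e) ρ = trans (-ᴾ-homo (normalise e) ρ) (cong -_ (normalise-correct e ρ))

  _≟ᴾ_ : DecidableEquality (Poly n)
  _≟ᴾ_ = List.≡-dec (×.≡-dec ℤ._≟_ _≟ₘ_)

  normalise-sound : ∀ (e e′ : Expr ℤ n) → True (normalise e ≟ᴾ normalise e′) → ∀ ρ → ⟦ e ⟧ ρ ≡ ⟦ e′ ⟧ ρ
  normalise-sound e e′ same ρ = begin
    ⟦ e ⟧ ρ              ≡⟨ normalise-correct e ρ ⟨
    ⟦ normalise e ⟧ₚ ρ   ≡⟨ cong (λ p → ⟦ p ⟧ₚ ρ) (toWitness same) ⟩
    ⟦ normalise e′ ⟧ₚ ρ  ≡⟨ normalise-correct e′ ρ ⟩
    ⟦ e′ ⟧ ρ             ∎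
    where open ≡-Reasoning

  _[_] : Expr ℤ n → Vec (Expr ℤ m) n → Expr ℤ m
  Κ c [ σ ] = Κ c
  Ι i [ σ ] = lookup σ i
  (e ⊕ e′) [ σ ] = e [ σ ] ⊕ e′ [ σ ]
  (e ⊗ e′) [ σ ] = e [ σ ] ⊗ e′ [ σ ]
  (e ⊛ k) [ σ ] = e [ σ ] ⊛ k
  (⊝ e) [ σ ] = ⊝ e [ σ ]

  ⟦_⟧* : Vec (Expr ℤ m) n → Vec ℤ m → Vec ℤ n
  ⟦ σ ⟧* ρ = Vec.map (λ s → ⟦ s ⟧ ρ) σ

  substitution-correct : ∀ (e : Expr ℤ n) (σ : Vec (Expr ℤ m) n) ρ → ⟦ e [ σ ] ⟧ ρ ≡ ⟦ e ⟧ (⟦ σ ⟧* ρ)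
  substitution-correct (Κ c) σ ρ = refl
  substitution-correct (Ι i) σ ρ = sym (lookup-map i (λ s → ⟦ s ⟧ ρ) σ)
  substitution-correct (e ⊕ e′) σ ρ = cong₂ _+_ (substitution-correct e σ ρ) (substitution-correct e′ σ ρ)
  substitution-correct (e ⊗ e′) σ ρ = cong₂ _*_ (substitution-correct e σ ρ) (substitution-correct e′ σ ρ)
  substitution-correct (e ⊛ k) σ ρ = cong (_^′ k) (substitution-correct e σ ρ)
  substitution-correct (⊝ e) σ ρ = cong -_ (substitution-correct e σ ρ)

  normalise-sound-[] : ∀ (e : Expr ℤ n) (σ : Vec (Expr ℤ m) n) e′ → True (normalise (e [ σ ]) ≟ᴾ normalise e′) →
                       ∀ ρ → ⟦ e ⟧ (⟦ σ ⟧* ρ) ≡ ⟦ e′ ⟧ ρ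
  normalise-sound-[] e σ e′ same ρ = trans (sym (substitution-correct e σ ρ)) (normalise-sound (e [ σ ]) e′ same ρ)

open SparsePolynomial using (⟦_⟧*; normalise-sound-[])

-- Expression syntax mirroring that of ℤ, so that ⟦_⟧ of a transcribed polynomial is
-- syntactically the original.
module ExprNotation {n : ℕ} where
  infixl 6 _+_ _-_
  infixl 7 _*_
  infix 8 -_

  _+_ _-_ _*_ : Expr ℤ n → Expr ℤ n → Expr ℤ n
  _+_ = _⊕_
  x - y = x ⊕ ⊝ y
  _*_ = _⊗_

  -_ : Expr ℤ n → Expr ℤ n
  -_ = ⊝_

  +_ : ℕ → Expr ℤ n
  + k = Κ (ℤ.+ k)

module CubicVariables where
  a003 a012 a021 a030 a102 a111 a120 a201 a210 a300 : Expr ℤ 10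
  a003 = Ι (# 0)
  a012 = Ι (# 1)
  a021 = Ι (# 2)
  a030 = Ι (# 3)
  a102 = Ι (# 4)
  a111 = Ι (# 5)
  a120 = Ι (# 6)
  a201 = Ι (# 7)
  a210 = Ι (# 8)
  a300 = Ι (# 9)

module WeierstrassVariables where
  a₁ a₂ a₃ a₄ a₆ : Expr ℤ 5
  a₁ = Ι (# 0)
  a₂ = Ι (# 1)
  a₃ = Ι (# 2)
  a₄ = Ι (# 3)
  a₆ = Ι (# 4)

coefficients : TernaryCubic → Vec ℤ 10
coefficients f = a003 ∷ a012 ∷ a021 ∷ a030 ∷ a102 ∷ a111 ∷ a120 ∷ a201 ∷ a210 ∷ a300 ∷ []
  where open TernaryCubic f

I-polynomial J-polynomial : Expr ℤ 10
I-polynomial =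
    (+ 144) * a003 * a021 * a120 * a300
    + (- (+ 48)) * a003 * a021 * a210 * a210
    + (- (+ 216)) * a003 * a030 * a111 * a300
    + (+ 144) * a003 * a030 * a201 * a210
    + (+ 24) * a003 * a111 * a120 * a210
    + (- (+ 48)) * a003 * a120 * a120 * a201
    + (- (+ 48)) * a012 * a012 * a120 * a300
    + (+ 16) * a012 * a012 * a210 * a210
    + (+ 24) * a012 * a021 * a111 * a300
    + (- (+ 16)) * a012 * a021 * a201 * a210
    + (+ 144) * a012 * a030 * a102 * a300
    + (- (+ 48)) * a012 * a030 * a201 * a201
    + (- (+ 16)) * a012 * a102 * a120 * a210
    + (- (+ 8)) * a012 * a111 * a111 * a210
    + (+ 24) * a012 * a111 * a120 * a201
    + (- (+ 48)) * a021 * a021 * a102 * a300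
    + (+ 16) * a021 * a021 * a201 * a201
    + (+ 24) * a021 * a102 * a111 * a210
    + (- (+ 16)) * a021 * a102 * a120 * a201
    + (- (+ 8)) * a021 * a111 * a111 * a201
    + (- (+ 48)) * a030 * a102 * a102 * a210
    + (+ 24) * a030 * a102 * a111 * a201
    + (+ 16) * a102 * a102 * a120 * a120
    + (- (+ 8)) * a102 * a111 * a111 * a120
    + (+ 1) * a111 * a111 * a111 * a111
  where
  open ExprNotation
  open CubicVariables
J-polynomial =
    (+ 5832) * a003 * a003 * a030 * a030 * a300 * a300
    + (- (+ 3888)) * a003 * a003 * a030 * a120 * a210 * a300
    + (+ 864) * a003 * a003 * a030 * a210 * a210 * a210
    + (+ 864) * a003 * a003 * a120 * a120 * a120 * a300
    + (- (+ 216)) * a003 * a003 * a120 * a120 * a210 * a210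
    + (- (+ 3888)) * a003 * a012 * a021 * a030 * a300 * a300
    + (+ 1296) * a003 * a012 * a021 * a120 * a210 * a300
    + (- (+ 288)) * a003 * a012 * a021 * a210 * a210 * a210
    + (+ 1296) * a003 * a012 * a030 * a111 * a210 * a300
    + (+ 1296) * a003 * a012 * a030 * a120 * a201 * a300
    + (- (+ 864)) * a003 * a012 * a030 * a201 * a210 * a210
    + (- (+ 864)) * a003 * a012 * a111 * a120 * a120 * a300
    + (+ 144) * a003 * a012 * a111 * a120 * a210 * a210
    + (+ 144) * a003 * a012 * a120 * a120 * a201 * a210
    + (+ 864) * a003 * a021 * a021 * a021 * a300 * a300
    + (- (+ 864)) * a003 * a021 * a021 * a111 * a210 * a300
    + (- (+ 864)) * a003 * a021 * a021 * a120 * a201 * a300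
    + (+ 576) * a003 * a021 * a021 * a201 * a210 * a210
    + (+ 1296) * a003 * a021 * a030 * a102 * a210 * a300
    + (+ 1296) * a003 * a021 * a030 * a111 * a201 * a300
    + (- (+ 864)) * a003 * a021 * a030 * a201 * a201 * a210
    + (- (+ 864)) * a003 * a021 * a102 * a120 * a120 * a300
    + (+ 144) * a003 * a021 * a102 * a120 * a210 * a210
    + (+ 648) * a003 * a021 * a111 * a111 * a120 * a300
    + (+ 72) * a003 * a021 * a111 * a111 * a210 * a210
    + (- (+ 720)) * a003 * a021 * a111 * a120 * a201 * a210
    + (+ 576) * a003 * a021 * a120 * a120 * a201 * a201
    + (- (+ 3888)) * a003 * a030 * a030 * a102 * a201 * a300
    + (+ 864) * a003 * a030 * a030 * a201 * a201 * a201
    + (+ 1296) * a003 * a030 * a102 * a111 * a120 * a300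
    + (- (+ 864)) * a003 * a030 * a102 * a111 * a210 * a210
    + (+ 1296) * a003 * a030 * a102 * a120 * a201 * a210
    + (- (+ 540)) * a003 * a030 * a111 * a111 * a111 * a300
    + (+ 648) * a003 * a030 * a111 * a111 * a201 * a210
    + (- (+ 864)) * a003 * a030 * a111 * a120 * a201 * a201
    + (+ 144) * a003 * a102 * a111 * a120 * a120 * a210
    + (- (+ 288)) * a003 * a102 * a120 * a120 * a120 * a201
    + (- (+ 36)) * a003 * a111 * a111 * a111 * a120 * a210
    + (+ 72) * a003 * a111 * a111 * a120 * a120 * a201
    + (+ 864) * a012 * a012 * a012 * a030 * a300 * a300
    + (- (+ 288)) * a012 * a012 * a012 * a120 * a210 * a300
    + (+ 64) * a012 * a012 * a012 * a210 * a210 * a210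
    + (- (+ 216)) * a012 * a012 * a021 * a021 * a300 * a300
    + (+ 144) * a012 * a012 * a021 * a111 * a210 * a300
    + (+ 144) * a012 * a012 * a021 * a120 * a201 * a300
    + (- (+ 96)) * a012 * a012 * a021 * a201 * a210 * a210
    + (- (+ 864)) * a012 * a012 * a030 * a102 * a210 * a300
    + (- (+ 864)) * a012 * a012 * a030 * a111 * a201 * a300
    + (+ 576) * a012 * a012 * a030 * a201 * a201 * a210
    + (+ 576) * a012 * a012 * a102 * a120 * a120 * a300
    + (- (+ 96)) * a012 * a012 * a102 * a120 * a210 * a210
    + (+ 72) * a012 * a012 * a111 * a111 * a120 * a300
    + (- (+ 48)) * a012 * a012 * a111 * a111 * a210 * a210
    + (+ 144) * a012 * a012 * a111 * a120 * a201 * a210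
    + (- (+ 216)) * a012 * a012 * a120 * a120 * a201 * a201
    + (+ 144) * a012 * a021 * a021 * a102 * a210 * a300
    + (+ 144) * a012 * a021 * a021 * a111 * a201 * a300
    + (- (+ 96)) * a012 * a021 * a021 * a201 * a201 * a210
    + (+ 1296) * a012 * a021 * a030 * a102 * a201 * a300
    + (- (+ 288)) * a012 * a021 * a030 * a201 * a201 * a201
    + (- (+ 720)) * a012 * a021 * a102 * a111 * a120 * a300
    + (+ 144) * a012 * a021 * a102 * a111 * a210 * a210
    + (- (+ 48)) * a012 * a021 * a102 * a120 * a201 * a210
    + (- (+ 36)) * a012 * a021 * a111 * a111 * a111 * a300
    + (- (+ 24)) * a012 * a021 * a111 * a111 * a201 * a210
    + (+ 144) * a012 * a021 * a111 * a120 * a201 * a201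
    + (- (+ 864)) * a012 * a030 * a102 * a102 * a120 * a300
    + (+ 576) * a012 * a030 * a102 * a102 * a210 * a210
    + (+ 648) * a012 * a030 * a102 * a111 * a111 * a300
    + (- (+ 720)) * a012 * a030 * a102 * a111 * a201 * a210
    + (+ 144) * a012 * a030 * a102 * a120 * a201 * a201
    + (+ 72) * a012 * a030 * a111 * a111 * a201 * a201
    + (- (+ 96)) * a012 * a102 * a102 * a120 * a120 * a210
    + (- (+ 24)) * a012 * a102 * a111 * a111 * a120 * a210
    + (+ 144) * a012 * a102 * a111 * a120 * a120 * a201
    + (+ 12) * a012 * a111 * a111 * a111 * a111 * a210
    + (- (+ 36)) * a012 * a111 * a111 * a111 * a120 * a201
    + (- (+ 288)) * a021 * a021 * a021 * a102 * a201 * a300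
    + (+ 64) * a021 * a021 * a021 * a201 * a201 * a201
    + (+ 576) * a021 * a021 * a102 * a102 * a120 * a300
    + (- (+ 216)) * a021 * a021 * a102 * a102 * a210 * a210
    + (+ 72) * a021 * a021 * a102 * a111 * a111 * a300
    + (+ 144) * a021 * a021 * a102 * a111 * a201 * a210
    + (- (+ 96)) * a021 * a021 * a102 * a120 * a201 * a201
    + (- (+ 48)) * a021 * a021 * a111 * a111 * a201 * a201
    + (- (+ 864)) * a021 * a030 * a102 * a102 * a111 * a300
    + (+ 144) * a021 * a030 * a102 * a102 * a201 * a210
    + (+ 144) * a021 * a030 * a102 * a111 * a201 * a201
    + (+ 144) * a021 * a102 * a102 * a111 * a120 * a210
    + (- (+ 96)) * a021 * a102 * a102 * a120 * a120 * a201
    + (- (+ 36)) * a021 * a102 * a111 * a111 * a111 * a210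
    + (- (+ 24)) * a021 * a102 * a111 * a111 * a120 * a201
    + (+ 12) * a021 * a111 * a111 * a111 * a111 * a201
    + (+ 864) * a030 * a030 * a102 * a102 * a102 * a300
    + (- (+ 216)) * a030 * a030 * a102 * a102 * a201 * a201
    + (- (+ 288)) * a030 * a102 * a102 * a102 * a120 * a210
    + (+ 72) * a030 * a102 * a102 * a111 * a111 * a210
    + (+ 144) * a030 * a102 * a102 * a111 * a120 * a201
    + (- (+ 36)) * a030 * a102 * a111 * a111 * a111 * a201
    + (+ 64) * a102 * a102 * a102 * a120 * a120 * a120
    + (- (+ 48)) * a102 * a102 * a111 * a111 * a120 * a120
    + (+ 12) * a102 * a111 * a111 * a111 * a111 * a120
    + (- (+ 1)) * a111 * a111 * a111 * a111 * a111 * a111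
  where
  open ExprNotation
  open CubicVariables

I-polynomial-correct : ∀ f → ⟦ I-polynomial ⟧ (coefficients f) ≡ I-numer f
I-polynomial-correct f = refl

J-polynomial-correct : ∀ f → ⟦ J-polynomial ⟧ (coefficients f) ≡ J-numer f
J-polynomial-correct f = refl

weierstrassCubicᵛ : Vec ℤ 5 → TernaryCubic
weierstrassCubicᵛ (a₁ ∷ a₂ ∷ a₃ ∷ a₄ ∷ a₆ ∷ []) = weierstrassCubic a₁ a₂ a₃ a₄ a₆

module WeierstrassInvariants where
  open ExprNotation
  open WeierstrassVariables

  weierstrassCoefficients : Vec (Expr ℤ 5) 10
  weierstrassCoefficients = - a₆ ∷ a₃ ∷ + 1 ∷ + 0 ∷ - a₄ ∷ a₁ ∷ + 0 ∷ - a₂ ∷ + 0 ∷ - (+ 1) ∷ []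

  b₂ b₄ b₆ c₄ c₆ : Expr ℤ 5
  b₂ = a₁ * a₁ + (+ 4) * a₂
  b₄ = a₁ * a₃ + (+ 2) * a₄
  b₆ = a₃ * a₃ + (+ 4) * a₆
  c₄ = b₂ * b₂ - (+ 24) * b₄
  c₆ = - (b₂ * b₂ * b₂) + (+ 36) * b₂ * b₄ - (+ 216) * b₆

open WeierstrassInvariants using (weierstrassCoefficients; c₄; c₆)

-- The Weierstrass coefficients of the Jacobian of f = 0, after Artin, Rodriguez-Villegas and Tate.
module JacobianModel where
  open ExprNotation
  open CubicVariables

  a₁ a₂ a₃ a₄ a₆ : Expr ℤ 10
  a₁ = a111
  a₂ =
    - (a102 * a120)
    - a021 * a201
    - a012 * a210
  a₃ =
    a030 * a102 * a201
    + a021 * a102 * a210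
    + a012 * a120 * a201
    + a012 * a021 * a300
    + a003 * a120 * a210
    + a003 * a030 * a300
  a₄ =
    - (a030 * a102 * a111 * a201)
    + a030 * a102 * a102 * a210
    + a021 * a102 * a120 * a201
    - a021 * a102 * a111 * a210
    + a021 * a021 * a102 * a300
    - a012 * a111 * a120 * a201
    + a012 * a102 * a120 * a210
    + a012 * a030 * a201 * a201
    - (+ 3) * a012 * a030 * a102 * a300
    + a012 * a021 * a201 * a210
    - a012 * a021 * a111 * a300
    + a012 * a012 * a120 * a300
    + a003 * a120 * a120 * a201
    - a003 * a111 * a120 * a210
    - (+ 3) * a003 * a030 * a201 * a210
    + (+ 4) * a003 * a030 * a111 * a300
    + a003 * a021 * a210 * a210
    - (+ 3) * a003 * a021 * a120 * a300
  a₆ =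
    - (a030 * a030 * a102 * a102 * a102 * a300)
    - a021 * a030 * a102 * a102 * a201 * a210
    + a021 * a030 * a102 * a102 * a111 * a300
    - a021 * a021 * a102 * a102 * a120 * a300
    - a012 * a030 * a102 * a120 * a201 * a201
    + a012 * a030 * a102 * a111 * a201 * a210
    - a012 * a030 * a102 * a111 * a111 * a300
    - a012 * a030 * a102 * a102 * a210 * a210
    + (+ 2) * a012 * a030 * a102 * a102 * a120 * a300
    - a012 * a021 * a102 * a120 * a201 * a210
    + a012 * a021 * a102 * a111 * a120 * a300
    - a012 * a021 * a030 * a102 * a201 * a300
    - a012 * a021 * a021 * a102 * a210 * a300
    - a012 * a012 * a102 * a120 * a120 * a300
    - a012 * a012 * a030 * a201 * a201 * a210
    + a012 * a012 * a030 * a111 * a201 * a300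
    + (+ 2) * a012 * a012 * a030 * a102 * a210 * a300
    - a012 * a012 * a021 * a120 * a201 * a300
    - a012 * a012 * a012 * a030 * a300 * a300
    + a003 * a030 * a111 * a120 * a201 * a201
    - a003 * a030 * a111 * a111 * a201 * a210
    + a003 * a030 * a111 * a111 * a111 * a300
    - a003 * a030 * a102 * a120 * a201 * a210
    + a003 * a030 * a102 * a111 * a210 * a210
    - (+ 3) * a003 * a030 * a102 * a111 * a120 * a300
    - a003 * a030 * a030 * a201 * a201 * a201
    + (+ 4) * a003 * a030 * a030 * a102 * a201 * a300
    - a003 * a021 * a120 * a120 * a201 * a201
    + a003 * a021 * a111 * a120 * a201 * a210
    - a003 * a021 * a111 * a111 * a120 * a300
    - a003 * a021 * a102 * a120 * a210 * a210
    + (+ 2) * a003 * a021 * a102 * a120 * a120 * a300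
    + (+ 2) * a003 * a021 * a030 * a201 * a201 * a210
    - (+ 3) * a003 * a021 * a030 * a111 * a201 * a300
    - (+ 2) * a003 * a021 * a030 * a102 * a210 * a300
    - a003 * a021 * a021 * a201 * a210 * a210
    + (+ 2) * a003 * a021 * a021 * a120 * a201 * a300
    + a003 * a021 * a021 * a111 * a210 * a300
    - a003 * a021 * a021 * a021 * a300 * a300
    - a003 * a012 * a120 * a120 * a201 * a210
    + a003 * a012 * a111 * a120 * a120 * a300
    + (+ 2) * a003 * a012 * a030 * a201 * a210 * a210
    - (+ 2) * a003 * a012 * a030 * a120 * a201 * a300
    - (+ 3) * a003 * a012 * a030 * a111 * a210 * a300
    - a003 * a012 * a021 * a120 * a210 * a300
    + (+ 4) * a003 * a012 * a021 * a030 * a300 * a300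
    - a003 * a003 * a120 * a120 * a120 * a300
    - a003 * a003 * a030 * a210 * a210 * a210
    + (+ 4) * a003 * a003 * a030 * a120 * a210 * a300
    - (+ 7) * a003 * a003 * a030 * a030 * a300 * a300

jacobian : Vec (Expr ℤ 10) 5
jacobian = a₁ ∷ a₂ ∷ a₃ ∷ a₄ ∷ a₆ ∷ []
  where open JacobianModel

coefficients-weierstrassCubicᵛ : ∀ a → coefficients (weierstrassCubicᵛ a) ≡ ⟦ weierstrassCoefficients ⟧* a
coefficients-weierstrassCubicᵛ (a₁ ∷ a₂ ∷ a₃ ∷ a₄ ∷ a₆ ∷ []) = refl

I-numer-weierstrass : ∀ a → I-numer (weierstrassCubicᵛ a) ≡ ⟦ c₄ ⟧ a
I-numer-weierstrass a = begin
  I-numer (weierstrassCubicᵛ a)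
    ≡⟨ I-polynomial-correct (weierstrassCubicᵛ a) ⟨
  ⟦ I-polynomial ⟧ (coefficients (weierstrassCubicᵛ a))
    ≡⟨ cong ⟦ I-polynomial ⟧ (coefficients-weierstrassCubicᵛ a) ⟩
  ⟦ I-polynomial ⟧ (⟦ weierstrassCoefficients ⟧* a)
    ≡⟨ normalise-sound-[] I-polynomial weierstrassCoefficients c₄ _ a ⟩
  ⟦ c₄ ⟧ a ∎
  where open ≡-Reasoning

J-numer-weierstrass : ∀ a → J-numer (weierstrassCubicᵛ a) ≡ ⟦ c₆ ⟧ a
J-numer-weierstrass a = begin
  J-numer (weierstrassCubicᵛ a)
    ≡⟨ J-polynomial-correct (weierstrassCubicᵛ a) ⟨
  ⟦ J-polynomial ⟧ (coefficients (weierstrassCubicᵛ a))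
    ≡⟨ cong ⟦ J-polynomial ⟧ (coefficients-weierstrassCubicᵛ a) ⟩
  ⟦ J-polynomial ⟧ (⟦ weierstrassCoefficients ⟧* a)
    ≡⟨ normalise-sound-[] J-polynomial weierstrassCoefficients c₆ _ a ⟩
  ⟦ c₆ ⟧ a ∎
  where open ≡-Reasoning

c₄-jacobian : ∀ f → ⟦ c₄ ⟧ (⟦ jacobian ⟧* (coefficients f)) ≡ I-numer f
c₄-jacobian f = trans (normalise-sound-[] c₄ jacobian I-polynomial _ (coefficients f)) (I-polynomial-correct f)

c₆-jacobian : ∀ f → ⟦ c₆ ⟧ (⟦ jacobian ⟧* (coefficients f)) ≡ J-numer f
c₆-jacobian f = trans (normalise-sound-[] c₆ jacobian J-polynomial _ (coefficients f)) (J-polynomial-correct f)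

invI-cong : ∀ {f g} → I-numer f ≡ I-numer g → invI f ≡ invI g
invI-cong = cong (ℚ._/ 16)

invJ-cong : ∀ {f g} → J-numer f ≡ J-numer g → invJ f ≡ invJ g
invJ-cong = cong (ℚ._/ 32)

-- The implicit arguments of invI-cong and invJ-cong are given: inferring them would make Agda
-- unfold invI, i.e. normalise a rational built from the substituted polynomials.
invI-jacobian : ∀ f → invI (weierstrassCubicᵛ (⟦ jacobian ⟧* (coefficients f))) ≡ invI f
invI-jacobian f =
  let a = ⟦ jacobian ⟧* (coefficients f) in
  invI-cong {weierstrassCubicᵛ a} {f} (trans (I-numer-weierstrass a) (c₄-jacobian f))

invJ-jacobian : ∀ f → invJ (weierstrassCubicᵛ (⟦ jacobian ⟧* (coefficients f))) ≡ invJ f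
invJ-jacobian f =
  let a = ⟦ jacobian ⟧* (coefficients f) in
  invJ-cong {weierstrassCubicᵛ a} {f} (trans (J-numer-weierstrass a) (c₆-jacobian f))

weierstrass-witness : ∀ {I J} a → invI (weierstrassCubicᵛ a) ≡ I → invJ (weierstrassCubicᵛ a) ≡ J →
  ∃[ a₁ ] ∃[ a₂ ] ∃[ a₃ ] ∃[ a₄ ] ∃[ a₆ ]
    (invI (weierstrassCubic a₁ a₂ a₃ a₄ a₆) ≡ I × invJ (weierstrassCubic a₁ a₂ a₃ a₄ a₆) ≡ J)
weierstrass-witness (a₁ ∷ a₂ ∷ a₃ ∷ a₄ ∷ a₆ ∷ []) I-eq J-eq = a₁ , a₂ , a₃ , a₄ , a₆ , I-eq , J-eq

proposition2p13 : (I J : ℚ) →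
    (∃[ f ] (invI f ≡ I × invJ f ≡ J))
      ⇔ (∃[ a₁ ] ∃[ a₂ ] ∃[ a₃ ] ∃[ a₄ ] ∃[ a₆ ]
           (invI (weierstrassCubic a₁ a₂ a₃ a₄ a₆) ≡ I
             × invJ (weierstrassCubic a₁ a₂ a₃ a₄ a₆) ≡ J))
proposition2p13 I J = mk⇔
  (λ (f , f-I , f-J) → weierstrass-witness (⟦ jacobian ⟧* (coefficients f))
                          (trans (invI-jacobian f) f-I) (trans (invJ-jacobian f) f-J))
  (λ (a₁ , a₂ , a₃ , a₄ , a₆ , invariants) → weierstrassCubic a₁ a₂ a₃ a₄ a₆ , invariants)
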